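{- Let $S$ be a non special numerical semigroup and $T=\mathcal{A}(S)$. Then $\operatorname{F}(T)=\operatorname{F}(S)$, $\operatorname{g}(T)=\operatorname{g}(S)$ and $\operatorname{n}(T)=\operatorname{n}(S)$.
   Context: $\mathbb{N}=\{0,1,2,\ldots\}$. A numerical semigroup is a submonoid $S$ of $(\mathbb{N},+)$ with $\mathbb{N}\setminus S$ finite. $\operatorname{H}(S)=\mathbb{N}\setminus S$; $\operatorname{g}(S)=|\operatorname{H}(S)|$; $\operatorname{F}(S)=\max\operatorname{H}(S)$; $\operatorname{m}(S)=\min(S\setminus\{0\})$; $\operatorname{n}(S)=|\{s\in S\mid s<\operatorname{F}(S)\}|$. Special gaps: $\operatorname{SG}(S)=\{h\in\operatorname{H}(S)\mid 2h\in S \text{ and } h+s\in S \text{ for all } s\in S\setminus\{0\}\}$. $S$ is special if there is no $h\in\operatorname{SG}(S)\setminus\{\operatorname{F}(S)\}$ with $h>\operatorname{m}(S)$. For a non special numerical semigroup $S$, let $h=\max(\operatorname{SG}(S)\setminus\{\operatorname{F}(S)\})$ and define $\mathcal{A}(S)=(S\cup\{h\})\setminus\{\operatorname{m}(S)\}$ (a numerical semigroup). -}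

module Defs where

open import Data.Bool using (Bool; true; false; if_then_else_; _∧_; not)
open import Data.Nat using (ℕ; zero; suc; _+_; _≤_; _<_)
open import Data.Integer as ℤ using (ℤ; +_; -[1+_])
open import Data.Product using (Σ; ∃; _×_; _,_; proj₁)
open import Relation.Binary.PropositionalEquality using (_≡_; _≢_)
open import Relation.Nullary using (¬_)
open import Data.Sum using (_⊎_)
open import Function.Bundles using (_⇔_)
open import Relation.Nullary.Decidable using (⌊_⌋)

record NumericalSemigroup : Set where
  field
    contains : ℕ → Bool
    zero∈    : contains 0 ≡ true
    closed   : ∀ a b → contains a ≡ true → contains b ≡ true → contains (a + b) ≡ true
    bound    : ℕ
    cofinite : ∀ x → bound ≤ x → contains x ≡ true

open NumericalSemigroup public

_∈S_ : ℕ → NumericalSemigroup → Set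
x ∈S S = contains S x ≡ true

_∉S_ : ℕ → NumericalSemigroup → Set
x ∉S S = contains S x ≡ false

count : (ℕ → Bool) → ℕ → ℕ
count P zero    = 0
count P (suc k) = if P k then suc (count P k) else count P k

lastFalse : (ℕ → Bool) → ℕ → ℤ
lastFalse P zero    = -[1+ 0 ]
lastFalse P (suc k) = if P k then lastFalse P k else + k

firstTrue : (ℕ → Bool) → (start fuel : ℕ) → ℕ
firstTrue P start zero       = start
firstTrue P start (suc fuel) = if P start then start else firstTrue P (suc start) fuel

-- genus g(S) = |H(S)|: all gaps lie below the bound
genus : NumericalSemigroup → ℕ
genus S = count (λ x → not (contains S x)) (bound S)

-- Frobenius number F(S) = max H(S)  (= -1 when H(S) is empty, as usual)
frobenius : NumericalSemigroup → ℤ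
frobenius S = lastFalse (contains S) (bound S)

-- multiplicity m(S) = min (S \ {0}); the search terminates since bound S + 1 ∈ S
multiplicity : NumericalSemigroup → ℕ
multiplicity S = firstTrue (contains S) 1 (bound S)

-- n(S) = |{ s ∈ S | s < F(S) }|  (all such s lie below the bound)
smallElements : NumericalSemigroup → ℕ
smallElements S =
  count (λ x → contains S x ∧ ⌊ + x ℤ.<? frobenius S ⌋) (bound S)

IsSpecialGap : NumericalSemigroup → ℕ → Set
IsSpecialGap S h =
  h ∉S S × (h + h) ∈S S × (∀ s → s ∈S S → s ≢ 0 → (h + s) ∈S S)

IsSpecial : NumericalSemigroup → Set
IsSpecial S = ¬ (∃ λ h → IsSpecialGap S h × (+ h ≢ frobenius S) × multiplicity S < h)

IsMaxSGnotF : NumericalSemigroup → ℕ → Set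
IsMaxSGnotF S h =
  (IsSpecialGap S h × (+ h ≢ frobenius S))
  × (∀ h' → IsSpecialGap S h' → + h' ≢ frobenius S → h' ≤ h)

IsA : NumericalSemigroup → NumericalSemigroup → Set
IsA S T =
  ∃ λ h → IsMaxSGnotF S h ×
    (∀ x → x ∈S T ⇔ ((x ∈S S ⊎ x ≡ h) × x ≢ multiplicity S))

{-# OPTIONS --safe #-}
module Submission where

-- Let m = m(S) and h = max (SG(S) \ {F(S)}). Non-speciality forces m < h, and h < F(S) since
-- h is a gap different from F(S). So T arises from S by moving one element from m up to h,
-- both below F(S): nothing changes above F(S), and the counts of gaps and of elements below
-- F(S) are unaffected by such a move.

open import Defs
open import Data.Bool using (Bool; true; false; not; _∧_)
open import Data.Bool.Properties using (∧-zeroʳ; not-¬; ¬-not)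
open import Data.Nat using (ℕ; zero; suc; _+_; _≤_; _<_; z≤n; s≤s; _<?_)
open import Data.Nat.Properties
open import Data.Integer as ℤ using (ℤ; +_)
import Data.Integer.Properties as ℤₚ
open import Data.Product using (∃; _×_; _,_; proj₁; proj₂)
open import Data.Sum using (_⊎_; inj₁; inj₂; [_,_]′)
open import Data.Empty using (⊥-elim)
open import Function.Bundles using (_⇔_; Equivalence)
open import Relation.Nullary using (¬_; yes; no)
open import Relation.Nullary.Decidable using (⌊_⌋; isYes≗does; dec-true; dec-false)
open import Relation.Binary.PropositionalEquality
  using (_≡_; _≢_; refl; sym; trans; cong; cong₂; subst; module ≡-Reasoning)

count-stable : (P : ℕ → Bool) {a k : ℕ} →
  (∀ x → a ≤ x → P x ≡ false) → a ≤ k → count P a ≡ count P k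
count-stable P {k = zero} _ z≤n = refl
count-stable P {a} {suc k} P≡false a≤1+k with m≤n⇒m<n∨m≡n a≤1+k
... | inj₂ refl = refl
... | inj₁ (s≤s a≤k) rewrite P≡false k a≤k = count-stable P P≡false a≤k

count-suc-cong : (A B : ℕ → Bool) {k n : ℕ} →
  A k ≡ B k → count A k ≡ n + count B k → count A (suc k) ≡ n + count B (suc k)
count-suc-cong A B {k} {n} Ak≡Bk c rewrite Ak≡Bk with B k
... | true  = trans (cong suc c) (sym (+-suc n (count B k)))
... | false = c

record Transposed (A B : ℕ → Bool) (a b : ℕ) : Set where
  field
    a<b   : a < b
    A-a   : A a ≡ true
    B-a   : B a ≡ false
    A-b   : A b ≡ false
    B-b   : B b ≡ true
    agree : ∀ x → x ≢ a → x ≢ b → A x ≡ B x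

transposed-not : {A B : ℕ → Bool} {a b : ℕ} →
  Transposed A B a b → Transposed (λ x → not (B x)) (λ x → not (A x)) a b
transposed-not t = record
  { a<b   = a<b
  ; A-a   = cong not B-a
  ; B-a   = cong not A-a
  ; A-b   = cong not B-b
  ; B-b   = cong not A-b
  ; agree = λ x x≢a x≢b → cong not (sym (agree x x≢a x≢b))
  }
  where open Transposed t

transposed-∧ : {A B : ℕ → Bool} {a b : ℕ} (c : ℕ → Bool) → c a ≡ true → c b ≡ true →
  Transposed A B a b → Transposed (λ x → A x ∧ c x) (λ x → B x ∧ c x) a b
transposed-∧ c c-a c-b t = record
  { a<b   = a<b
  ; A-a   = cong₂ _∧_ A-a c-a
  ; B-a   = cong (_∧ c _) B-a
  ; A-b   = cong (_∧ c _) A-b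
  ; B-b   = cong₂ _∧_ B-b c-b
  ; agree = λ x x≢a x≢b → cong (_∧ c x) (agree x x≢a x≢b)
  }
  where open Transposed t

module _ {A B : ℕ → Bool} {a b : ℕ} (t : Transposed A B a b) where
  open Transposed t

  private
    count-below : ∀ k → k ≤ a → count A k ≡ count B k
    count-below zero    _   = refl
    count-below (suc k) k<a =
      count-suc-cong A B (agree k (<⇒≢ k<a) (<⇒≢ (<-trans k<a a<b))) (count-below k (<⇒≤ k<a))

    count-between : ∀ k → a < k → k ≤ b → count A k ≡ 1 + count B k
    count-between (suc j) (s≤s a≤j) j<b with m≤n⇒m<n∨m≡n a≤j
    ... | inj₂ refl rewrite A-a | B-a = cong suc (count-below j ≤-refl)
    ... | inj₁ a<j =
      count-suc-cong A B (agree j (>⇒≢ a<j) (<⇒≢ j<b)) (count-between j a<j (<⇒≤ j<b))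

  count-transposed : ∀ k → b < k → count A k ≡ count B k
  count-transposed (suc j) (s≤s b≤j) with m≤n⇒m<n∨m≡n b≤j
  ... | inj₂ refl rewrite A-b | B-b = count-between j a<b ≤-refl
  ... | inj₁ b<j =
    count-suc-cong A B (agree j (>⇒≢ (<-trans a<b b<j)) (>⇒≢ b<j)) (count-transposed j b<j)

lastFalse<bound : (P : ℕ → Bool) (k : ℕ) → lastFalse P k ℤ.< + k
lastFalse<bound P zero = ℤ.-<+
lastFalse<bound P (suc k) with P k
... | true  = ℤₚ.<-trans (lastFalse<bound P k) (ℤ.+<+ (n<1+n k))
... | false = ℤ.+<+ (n<1+n k)

lastFalse-last : (P : ℕ → Bool) {f k : ℕ} → P f ≡ false → f < k →
  (∀ x → f < x → x < k → P x ≡ true) → lastFalse P k ≡ + f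
lastFalse-last P {k = suc k} Pf (s≤s f≤k) above with m≤n⇒m<n∨m≡n f≤k
... | inj₂ refl rewrite Pf = refl
... | inj₁ f<k rewrite above k f<k (n<1+n k) =
  lastFalse-last P Pf f<k (λ x f<x x<k → above x f<x (<-trans x<k (n<1+n k)))

last-false-exists : (P : ℕ → Bool) {x k : ℕ} → P x ≡ false → x < k →
  ∃ λ f → P f ≡ false × x ≤ f × f < k × (∀ y → f < y → y < k → P y ≡ true)
last-false-exists P {x} {suc k} Px x<1+k with P k in Pk
... | false = k , Pk , ≤-pred x<1+k , n<1+n k ,
  λ y k<y y<1+k → ⊥-elim (<⇒≱ k<y (≤-pred y<1+k))
... | true with last-false-exists P Px (≤∧≢⇒< (≤-pred x<1+k) λ { refl → not-¬ Pk Px })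
...   | f , Pf , x≤f , f<k , above = f , Pf , x≤f , <-trans f<k (n<1+n k) , above′
  where
  above′ : ∀ y → f < y → y < suc k → P y ≡ true
  above′ y f<y y<1+k with m≤n⇒m<n∨m≡n (≤-pred y<1+k)
  ... | inj₁ y<k  = above y f<y y<k
  ... | inj₂ refl = Pk

firstTrue-true : (P : ℕ → Bool) (start fuel : ℕ) →
  P (start + fuel) ≡ true → P (firstTrue P start fuel) ≡ true
firstTrue-true P start zero e = subst (λ n → P n ≡ true) (+-identityʳ start) e
firstTrue-true P start (suc fuel) e with P start in P-start
... | true  = P-start
... | false = firstTrue-true P (suc start) fuel (subst (λ n → P n ≡ true) (+-suc start fuel) e)

IsFrobeniusNumber : NumericalSemigroup → ℕ → Set
IsFrobeniusNumber S f = f ∉S S × (∀ x → f < x → x ∈S S)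

module _ (S : NumericalSemigroup) where

  gap<bound : ∀ {x} → x ∉S S → x < bound S
  gap<bound {x} x∉S = ≰⇒> λ bound≤x → not-¬ (cofinite S x bound≤x) x∉S

  frobenius-≡ : ∀ {f} → IsFrobeniusNumber S f → frobenius S ≡ + f
  frobenius-≡ (f∉S , above) =
    lastFalse-last (contains S) f∉S (gap<bound f∉S) (λ x f<x _ → above x f<x)

  frobenius-above-gap : ∀ {x} → x ∉S S → ∃ λ f → IsFrobeniusNumber S f × x ≤ f
  frobenius-above-gap x∉S with last-false-exists (contains S) x∉S (gap<bound x∉S)
  ... | f , f∉S , x≤f , _ , above = f , (f∉S , above′) , x≤f
    where
    above′ : ∀ y → f < y → y ∈S S
    above′ y f<y with y <? bound S
    ... | yes y<bound = above y f<y y<bound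
    ... | no  y≮bound = cofinite S y (≮⇒≥ y≮bound)

  multiplicity∈ : multiplicity S ∈S S
  multiplicity∈ = firstTrue-true (contains S) 1 (bound S) (cofinite S (suc (bound S)) (n≤1+n _))

  genus-count : ∀ {k} → bound S ≤ k → genus S ≡ count (λ x → not (contains S x)) k
  genus-count = count-stable _ (λ x bound≤x → cong not (cofinite S x bound≤x))

  memberBelow : ℤ → ℕ → Bool
  memberBelow z x = contains S x ∧ ⌊ + x ℤ.<? z ⌋

  smallElements-count : ∀ {k} → bound S ≤ k → smallElements S ≡ count (memberBelow (frobenius S)) k
  smallElements-count = count-stable _ λ x bound≤x →
    trans (cong (contains S x ∧_) (not-below-frobenius bound≤x)) (∧-zeroʳ _)
    where
    not-below-frobenius : ∀ {x} → bound S ≤ x → ⌊ + x ℤ.<? frobenius S ⌋ ≡ false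
    not-below-frobenius {x} bound≤x = trans (isYes≗does _) (dec-false (+ x ℤ.<? frobenius S) λ x<F →
      <⇒≱ (ℤₚ.drop‿+<+ (ℤₚ.<-trans x<F (lastFalse<bound (contains S) (bound S)))) bound≤x)

transposition-invariants : (S T : NumericalSemigroup) {m h f : ℕ} →
  IsFrobeniusNumber S f → h < f → Transposed (contains S) (contains T) m h →
  (frobenius T ≡ frobenius S) × (genus T ≡ genus S) × (smallElements T ≡ smallElements S)
transposition-invariants S T {m} {h} {f} frobS@(f∉S , above-f) h<f t = F≡ , g≡ , n≡
  where
  open Transposed t
  open ≡-Reasoning

  m<f : m < f
  m<f = <-trans a<b h<f

  frobT : IsFrobeniusNumber T f
  frobT = trans (sym (agree f (>⇒≢ m<f) (>⇒≢ h<f))) f∉S ,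
    λ x f<x → trans (sym (agree x (>⇒≢ (<-trans m<f f<x)) (>⇒≢ (<-trans h<f f<x)))) (above-f x f<x)

  F≡ : frobenius T ≡ frobenius S
  F≡ = trans (frobenius-≡ T frobT) (sym (frobenius-≡ S frobS))

  N : ℕ
  N = bound S + bound T

  h<N : h < N
  h<N = <-≤-trans (gap<bound S A-b) (m≤m+n (bound S) (bound T))

  g≡ : genus T ≡ genus S
  g≡ = begin
    genus T                                ≡⟨ genus-count T (m≤n+m (bound T) (bound S)) ⟩
    count (λ x → not (contains T x)) N     ≡⟨ count-transposed (transposed-not t) N h<N ⟩
    count (λ x → not (contains S x)) N     ≡⟨ genus-count S (m≤m+n (bound S) (bound T)) ⟨
    genus S                                ∎

  below-F : ∀ {x} → x < f → ⌊ + x ℤ.<? frobenius S ⌋ ≡ true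
  below-F {x} x<f = trans (isYes≗does _) (dec-true (+ x ℤ.<? frobenius S)
    (subst (+ x ℤ.<_) (sym (frobenius-≡ S frobS)) (ℤ.+<+ x<f)))

  transposed-below-F : Transposed (memberBelow S (frobenius S)) (memberBelow T (frobenius S)) m h
  transposed-below-F = transposed-∧ (λ x → ⌊ + x ℤ.<? frobenius S ⌋) (below-F m<f) (below-F h<f) t

  n≡ : smallElements T ≡ smallElements S
  n≡ = begin
    smallElements T                        ≡⟨ smallElements-count T (m≤n+m (bound T) (bound S)) ⟩
    count (memberBelow T (frobenius T)) N  ≡⟨ cong (λ z → count (memberBelow T z) N) F≡ ⟩
    count (memberBelow T (frobenius S)) N  ≡⟨ count-transposed transposed-below-F N h<N ⟨
    count (memberBelow S (frobenius S)) N  ≡⟨ smallElements-count S (m≤m+n (bound S) (bound T)) ⟨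
    smallElements S                        ∎

multiplicity<maxSpecialGap : (S : NumericalSemigroup) {h : ℕ} →
  ¬ IsSpecial S → IsMaxSGnotF S h → multiplicity S < h
multiplicity<maxSpecialGap S {h} nonSpecial (_ , maximal) with multiplicity S <? h
... | yes m<h = m<h
... | no  m≮h = ⊥-elim (nonSpecial λ (h′ , h′-sg , h′≢F , m<h′) →
  m≮h (<-≤-trans m<h′ (maximal h′ h′-sg h′≢F)))

remove-add-transposed : (S T : NumericalSemigroup) {m h : ℕ} → m ∈S S → h ∉S S → m < h →
  (∀ x → x ∈S T ⇔ ((x ∈S S ⊎ x ≡ h) × x ≢ m)) → Transposed (contains S) (contains T) m h
remove-add-transposed S T {m} {h} m∈S h∉S m<h T≈ = record
  { a<b   = m<h
  ; A-a   = m∈S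
  ; B-a   = ¬-not λ m∈T → proj₂ (to m m∈T) refl
  ; A-b   = h∉S
  ; B-b   = from h (inj₂ refl , >⇒≢ m<h)
  ; agree = agree
  }
  where
  to : ∀ x → x ∈S T → (x ∈S S ⊎ x ≡ h) × x ≢ m
  to x = Equivalence.to (T≈ x)

  from : ∀ x → (x ∈S S ⊎ x ≡ h) × x ≢ m → x ∈S T
  from x = Equivalence.from (T≈ x)

  agree : ∀ x → x ≢ m → x ≢ h → contains S x ≡ contains T x
  agree x x≢m x≢h with contains S x in Sx
  ... | true  = sym (from x (inj₁ Sx , x≢m))
  ... | false = sym (¬-not λ x∈T → [ (λ x∈S → not-¬ x∈S Sx) , x≢h ]′ (proj₁ (to x x∈T)))

proposition4p3 : (S T : NumericalSemigroup) → ¬ IsSpecial S → IsA S T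
    → (frobenius T ≡ frobenius S) × (genus T ≡ genus S) × (smallElements T ≡ smallElements S)
proposition4p3 S T nonSpecial (h , isMax@((h-sg , h≢F) , _) , T≈)
  with frobenius-above-gap S (proj₁ h-sg)
... | f , frobS , h≤f = transposition-invariants S T frobS h<f
  (remove-add-transposed S T (multiplicity∈ S) (proj₁ h-sg) (multiplicity<maxSpecialGap S nonSpecial isMax) T≈)
  where
  h<f : h < f
  h<f = ≤∧≢⇒< h≤f λ h≡f → h≢F (trans (cong +_ h≡f) (sym (frobenius-≡ S frobS)))
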